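{- Let $n>4$ and let $W_n$ be the wheel graph on $n$ vertices. Then $T_1(W_n)=2$ and $B_1(W_n)=1$.
   Context: The wheel graph $W_n$ consists of a cycle on $n-1$ vertices (the outer cycle) together with one additional vertex (the hub) adjacent to every vertex of the cycle; the edges from the hub are called spokes. A tile is a vertex together with a finite multiset of half-edges, each half-edge labeled by a cohesive-end symbol $a$ or its complement $\hat a$, where $a$ ranges over an alphabet of bond-edge types; a tile is written as a multiset such as $\{a,\hat a^2\}$. A pot $P$ is a finite set of distinct tile types. A graph $G$ (loops and multiple edges allowed) is realized (constructed) by $P$ if each vertex of $G$ can be assigned a copy of some tile type in $P$ (any number of copies of each type may be used) so that the half-edges at each vertex are in bijection with the edge-ends at that vertex and every edge of $G$ is formed by joining a half-edge labeled $a$ with a half-edge labeled $\hat a$ for some bond-edge type $a$, with no half-edge left unmatched. $C(P)$ denotes the set of graphs realized by $P$, and $C_{min}(P)$ the set of graphs of minimum order in $C(P)$. For a target graph $G$: in Scenario 1 the only requirement on $P$ is $G\in C(P)$; in Scenario 2 one requires $G\in C(P)$ and that no graph of smaller order than $G$ is in $C(P)$; in Scenario 3 one requires $C_{min}(P)=\{G\}$ (up to isomorphism), i.e. $P$ realizes no graph of smaller order and no graph of the same order nonisomorphic to $G$. $B_i(G)$ is the minimum number of bond-edge types, and $T_i(G)$ the minimum number of tile types, over all pots satisfying the requirements of Scenario $i$ for $G$. -}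

module Defs where

open import Data.Nat using (ℕ; zero; suc; _+_; _≤_)
open import Data.Bool using (Bool; true; false; not; if_then_else_; _∧_)
open import Data.Fin using (Fin; zero; suc; inject₁; fromℕ) renaming (_≟_ to _≟ᶠ_)
open import Data.Bool.Properties using () renaming (_≟_ to _≟ᵇ_)
open import Data.List using (List; []; _∷_; _++_; map; length; allFin; lookup)
open import Data.Nat.ListAction using (sum)
open import Relation.Binary.PropositionalEquality using (_≡_)
open import Data.List.Relation.Unary.Unique.Propositional using (Unique)
open import Data.Product using (_×_; _,_; proj₁; proj₂; Σ; ∃)
open import Relation.Nullary using (does)

-- A (multi)graph on the vertex set Fin n, loops and multiple edges allowed:
-- a finite list of edges, each given by its two endpoints.
Graph : ℕ → Set
Graph n = List (Fin n × Fin n)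

-- Cohesive-end labels over an alphabet of k bond-edge types:
-- (a , false) is the symbol a, (a , true) is its complement â.
Label : ℕ → Set
Label k = Fin k × Bool

-- A tile type is a finite multiset of half-edge labels,
-- represented by its multiplicity function.
Tile : ℕ → Set
Tile k = Label k → ℕ

record Pot (k : ℕ) : Set where
  field
    tiles    : List (Tile k)
    distinct : Unique tiles
open Pot public

#tiles : ∀ {k} → Pot k → ℕ
#tiles P = length (tiles P)

[_] : Bool → ℕ
[ true ]  = 1
[ false ] = 0

-- Given a labelling of the edges of G (for each edge a bond-edge type a and an
-- orientation o : the first end gets (a , o), the second end gets (a , not o)),
-- the number of edge-ends at vertex v carrying label ℓ (loops count twice).
endCount : ∀ {n k} (G : Graph n) → (Fin (length G) → Label k) → Fin n → Label k → ℕ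
endCount {k = k} G lab v (b , h) = sum (map f (allFin (length G)))
  where
  f : Fin (length G) → ℕ
  f e = [ does (proj₁ (lookup G e) ≟ᶠ v) ∧ does (proj₁ (lab e) ≟ᶠ b) ∧ does (proj₂ (lab e) ≟ᵇ h) ]
      + [ does (proj₂ (lookup G e) ≟ᶠ v) ∧ does (proj₁ (lab e) ≟ᶠ b) ∧ does (not (proj₂ (lab e)) ≟ᵇ h) ]

-- G ∈ C(P): every vertex gets a copy of a tile type of P, every edge is formed by
-- joining a half-edge a with a half-edge â, and at each vertex the multiset of
-- half-edge labels of its tile equals the multiset of labels of its edge-ends.
Realizes : ∀ {n k} → Pot k → Graph n → Set
Realizes {n} {k} P G =
  Σ (Fin n → Fin (#tiles P)) λ assign →
  Σ (Fin (length G) → Label k) λ lab →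
  ∀ (v : Fin n) (ℓ : Label k) → endCount G lab v ℓ ≡ lookup (tiles P) (assign v) ℓ

T₁-is : ∀ {n} → Graph n → ℕ → Set
T₁-is G t =
  (Σ ℕ λ k → Σ (Pot k) λ P → Realizes P G × #tiles P ≡ t)
  × (∀ k (P : Pot k) → Realizes P G → t ≤ #tiles P)

B₁-is : ∀ {n} → Graph n → ℕ → Set
B₁-is G b =
  (Σ (Pot b) λ P → Realizes P G)
  × (∀ k (P : Pot k) → Realizes P G → b ≤ k)

-- Wheel graph W_n on n vertices: hub = vertex zero, outer cycle on the n-1
-- vertices suc j (j : Fin (n-1)); defined for n ≥ 2 (only used for n > 4).
cycleEdges : ∀ c → List (Fin (suc c) × Fin (suc c))
cycleEdges c = (fromℕ c , zero) ∷ map (λ i → inject₁ i , suc i) (allFin c)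

wheel : (n : ℕ) → Graph n
wheel (suc (suc c)) =
  map (λ j → zero , suc j) (allFin (suc c))
  ++ map (λ e → suc (proj₁ e) , suc (proj₂ e)) (cycleEdges c)
wheel _ = []

-- A pot realizing G assigns to every vertex a tile whose size (number of half-edges)
-- equals the degree of the vertex.  For n > 4 the hub of W_n has degree n - 1 ≥ 4 while
-- the rim vertices have degree 3, so a single tile type cannot suffice; and W_n has an
-- edge, so at least one bond-edge type is needed.  Conversely the two tiles {â^(n-1)}
-- (hub) and {a², â} (rim) over one bond-edge type realize W_n: give every spoke its â
-- end at the hub, and direct the rim edges around the cycle with the â end at the head,
-- so that each rim vertex receives a from its spoke and from its outgoing rim edge.
module Submission where

open import Defs
open import Data.Nat using (ℕ; zero; suc; _+_; _*_; _≤_; _<_; z≤n; s≤s; >-nonZero⁻¹)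
open import Data.Nat.Properties using (+-identityʳ; +-0-commutativeMonoid; <-irrefl; 0≢1+n)
open import Data.Nat.ListAction using (sum)
open import Data.Nat.ListAction.Properties using (sum-++)
open import Data.Bool using (Bool; true; false; not; _∧_)
open import Data.Bool.Properties using (∧-identityʳ; ∧-zeroʳ) renaming (_≟_ to _≟ᵇ_)
open import Data.Fin using (Fin; zero; suc; inject₁; fromℕ; _≟_)
open import Data.Fin.Properties using (nonZeroIndex)
open import Data.List using (List; []; _∷_; _++_; map; length; allFin; lookup; tabulate)
open import Data.List.Properties using (map-++; map-∘; map-tabulate)
open import Data.List.Relation.Unary.AllPairs using ([]; _∷_)
open import Data.List.Relation.Unary.All using ([]; _∷_)
open import Data.Product using (_×_; _,_; proj₁)
open import Function using (_∘_; id)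
open import Relation.Binary.PropositionalEquality
  using (_≡_; _≢_; refl; sym; trans; cong; cong₂; module ≡-Reasoning)
open import Relation.Nullary using (does; contradiction)
open import Algebra.Properties.CommutativeMonoid.Sum +-0-commutativeMonoid
  using (sum-syntax; sum-cong-≗; sum-replicate-zero; ∑-distrib-+; ∑-comm)

open ≡-Reasoning

sum-tabulate : ∀ {m} (f : Fin m → ℕ) → sum (tabulate f) ≡ ∑[ i < m ] f i
sum-tabulate {zero}  f = refl
sum-tabulate {suc m} f = cong (f zero +_) (sum-tabulate (f ∘ suc))

sum-map-allFin : ∀ m (f : Fin m → ℕ) → sum (map f (allFin m)) ≡ ∑[ i < m ] f i
sum-map-allFin m f = trans (cong sum (map-tabulate id f)) (sum-tabulate f)

sum-map-map-allFin : ∀ {A : Set} m (F : A → ℕ) (g : Fin m → A) →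
                     sum (map F (map g (allFin m))) ≡ ∑[ i < m ] F (g i)
sum-map-map-allFin m F g = trans (cong sum (sym (map-∘ (allFin m)))) (sum-map-allFin m (F ∘ g))

∑-lookup : ∀ {A : Set} (xs : List A) (f : A → ℕ) → ∑[ e < length xs ] f (lookup xs e) ≡ sum (map f xs)
∑-lookup []       f = refl
∑-lookup (x ∷ xs) f = cong (f x +_) (∑-lookup xs f)

∑-1 : ∀ m → ∑[ i < m ] 1 ≡ m
∑-1 zero    = refl
∑-1 (suc m) = cong suc (∑-1 m)

∑-[≟] : ∀ {m} (j : Fin m) → ∑[ i < m ] [ does (i ≟ j) ] ≡ 1
∑-[≟] {suc m} zero    = cong suc (sum-replicate-zero m)
∑-[≟] {suc m} (suc j) = ∑-[≟] j

∑-[≟]* : ∀ {m} (j : Fin m) c → ∑[ i < m ] ([ does (j ≟ i) ] * c) ≡ c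
∑-[≟]* {suc m} zero c = trans (cong₂ _+_ (+-identityʳ c) (sum-replicate-zero m)) (+-identityʳ c)
∑-[≟]* {suc m} (suc j) c = ∑-[≟]* j c

-- Every vertex of the cycle fromℕ c → 0 → 1 → ⋯ → fromℕ c on Fin (suc c) is the tail
-- of exactly one of its edges.
∑-[fromℕ≟]-inject₁ : ∀ c (w : Fin (suc c)) →
                     [ does (fromℕ c ≟ w) ] + ∑[ i < c ] [ does (inject₁ i ≟ w) ] ≡ 1
∑-[fromℕ≟]-inject₁ zero    zero    = refl
∑-[fromℕ≟]-inject₁ (suc c) zero    = cong suc (sum-replicate-zero c)
∑-[fromℕ≟]-inject₁ (suc c) (suc w) = ∑-[fromℕ≟]-inject₁ c w

ends : ∀ {n k} → Fin n × Fin n → Label k → Fin n → Label k → ℕ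
ends (x , y) (a , o) v (b , h) =
  [ does (x ≟ v) ∧ does (a ≟ b) ∧ does (o ≟ᵇ h) ] + [ does (y ≟ v) ∧ does (a ≟ b) ∧ does (not o ≟ᵇ h) ]

endCount-∑ : ∀ {n k} (G : Graph n) (lab : Fin (length G) → Label k) v ℓ →
             endCount G lab v ℓ ≡ ∑[ e < length G ] ends (lookup G e) (lab e) v ℓ
endCount-∑ G lab v ℓ = sum-map-allFin (length G) _

incidence : ∀ {n} → Fin n → Fin n × Fin n → ℕ
incidence v (x , y) = [ does (x ≟ v) ] + [ does (y ≟ v) ]

deg : ∀ {n} → Graph n → Fin n → ℕ
deg G v = sum (map (incidence v) G)

size : ∀ {k} → Tile k → ℕ
size {k} t = ∑[ a < k ] (t (a , false) + t (a , true))

[∧∧]-split : ∀ x y m o →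
  ([ x ∧ m ∧ does (o ≟ᵇ false) ] + [ y ∧ m ∧ does (not o ≟ᵇ false) ])
  + ([ x ∧ m ∧ does (o ≟ᵇ true) ] + [ y ∧ m ∧ does (not o ≟ᵇ true) ])
  ≡ [ m ] * ([ x ] + [ y ])
[∧∧]-split false false false false = refl
[∧∧]-split false false false true  = refl
[∧∧]-split false false true  false = refl
[∧∧]-split false false true  true  = refl
[∧∧]-split false true  false false = refl
[∧∧]-split false true  false true  = refl
[∧∧]-split false true  true  false = refl
[∧∧]-split false true  true  true  = refl
[∧∧]-split true  false false false = refl
[∧∧]-split true  false false true  = refl
[∧∧]-split true  false true  false = refl
[∧∧]-split true  false true  true  = refl
[∧∧]-split true  true  false false = refl
[∧∧]-split true  true  false true  = refl
[∧∧]-split true  true  true  false = refl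
[∧∧]-split true  true  true  true  = refl

size-ends : ∀ {n k} (p : Fin n × Fin n) (ℓ : Label k) v → size (ends p ℓ v) ≡ incidence v p
size-ends (x , y) (a , o) v = trans
  (sum-cong-≗ λ b → [∧∧]-split (does (x ≟ v)) (does (y ≟ v)) (does (a ≟ b)) o)
  (∑-[≟]* a (incidence v (x , y)))

size-endCount : ∀ {n k} (G : Graph n) (lab : Fin (length G) → Label k) v →
                size (endCount G lab v) ≡ deg G v
size-endCount {k = k} G lab v = begin
  size (endCount G lab v)
    ≡⟨ sum-cong-≗ (λ a → cong₂ _+_ (endCount-∑ G lab v (a , false)) (endCount-∑ G lab v (a , true))) ⟩
  ∑[ a < k ] (∑[ e < m ] E e (a , false) + ∑[ e < m ] E e (a , true))
    ≡⟨ sum-cong-≗ (λ a → sym (∑-distrib-+ (λ e → E e (a , false)) (λ e → E e (a , true)))) ⟩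
  ∑[ a < k ] ∑[ e < m ] (E e (a , false) + E e (a , true))
    ≡⟨ ∑-comm (λ a e → E e (a , false) + E e (a , true)) ⟩
  ∑[ e < m ] size (E e)
    ≡⟨ sum-cong-≗ (λ e → size-ends (lookup G e) (lab e) v) ⟩
  ∑[ e < m ] incidence v (lookup G e)
    ≡⟨ ∑-lookup G (incidence v) ⟩
  deg G v ∎
  where
  m : ℕ
  m = length G
  E : Fin m → Tile k
  E e = ends (lookup G e) (lab e) v

deg≡size : ∀ {n k} (P : Pot k) (G : Graph n) (r : Realizes P G) v →
           deg G v ≡ size (lookup (tiles P) (proj₁ r v))
deg≡size P G (assign , lab , realizes) v = trans
  (sym (size-endCount G lab v))
  (sum-cong-≗ λ a → cong₂ _+_ (realizes v (a , false)) (realizes v (a , true)))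

distinct⇒2≤ : ∀ {m} (i j : Fin m) → i ≢ j → 2 ≤ m
distinct⇒2≤ {suc zero}    zero zero i≢j = contradiction refl i≢j
distinct⇒2≤ {suc (suc _)} _    _    _   = s≤s (s≤s z≤n)

irregular⇒2≤#tiles : ∀ {n k} (P : Pot k) (G : Graph n) → Realizes P G →
                     ∀ u v → deg G u ≢ deg G v → 2 ≤ #tiles P
irregular⇒2≤#tiles P G r u v degu≢degv = distinct⇒2≤ (proj₁ r u) (proj₁ r v) λ same →
  degu≢degv (trans (deg≡size P G r u) (trans (cong (size ∘ lookup (tiles P)) same) (sym (deg≡size P G r v))))

edge⇒1≤#bonds : ∀ {n k} (P : Pot k) (G : Graph n) → Realizes P G → Fin (length G) → 1 ≤ k
edge⇒1≤#bonds {k = k} P G (_ , lab , _) e = >-nonZero⁻¹ k {{nonZeroIndex (proj₁ (lab e))}}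

sum-map-wheel : ∀ c (F : Fin (suc (suc c)) × Fin (suc (suc c)) → ℕ) →
  sum (map F (wheel (suc (suc c))))
  ≡ ∑[ j < suc c ] F (zero , suc j) + (F (suc (fromℕ c) , suc zero) + ∑[ i < c ] F (suc (inject₁ i) , suc (suc i)))
sum-map-wheel c F = begin
  sum (map F (spokes ++ rim))           ≡⟨ cong sum (map-++ F spokes rim) ⟩
  sum (map F spokes ++ map F rim)       ≡⟨ sum-++ (map F spokes) (map F rim) ⟩
  sum (map F spokes) + sum (map F rim)  ≡⟨ cong₂ _+_ (sum-map-map-allFin (suc c) F spoke) rim-sum ⟩
  _                                     ∎
  where
  spoke : Fin (suc c) → Fin (suc (suc c)) × Fin (suc (suc c))
  spoke j = zero , suc j
  shift : Fin (suc c) × Fin (suc c) → Fin (suc (suc c)) × Fin (suc (suc c))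
  shift (x , y) = suc x , suc y
  spokes rim : Graph (suc (suc c))
  spokes = map spoke (allFin (suc c))
  rim = map shift (cycleEdges c)
  rim-sum : sum (map F rim) ≡ F (suc (fromℕ c) , suc zero) + ∑[ i < c ] F (suc (inject₁ i) , suc (suc i))
  rim-sum = cong (F (suc (fromℕ c) , suc zero) +_) (trans
    (cong sum (sym (map-∘ (map (λ i → inject₁ i , suc i) (allFin c)))))
    (sum-map-map-allFin c (F ∘ shift) (λ i → inject₁ i , suc i)))

hubTile : ℕ → Tile 1
hubTile d (_ , false) = 0
hubTile d (_ , true)  = d

rimTile : Tile 1
rimTile (_ , false) = 2
rimTile (_ , true)  = 1

wheelPot : ℕ → Pot 1
wheelPot d = record { tiles = hubTile d ∷ rimTile ∷ [] ; distinct = (hub≢rim ∷ []) ∷ [] ∷ [] }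
  where
  hub≢rim : hubTile d ≢ rimTile
  hub≢rim eq = 0≢1+n (cong (λ t → t (zero , false)) eq)

orientation : ∀ {n} → Fin (suc n) × Fin (suc n) → Label 1
orientation (zero  , _) = zero , true
orientation (suc _ , _) = zero , false

[∧true]+[∧false] : ∀ x y → [ x ∧ true ] + [ y ∧ false ] ≡ [ x ]
[∧true]+[∧false] false y = cong [_] (∧-zeroʳ y)
[∧true]+[∧false] true  y = cong (1 +_) (cong [_] (∧-zeroʳ y))

[∧false]+[∧true] : ∀ x y → [ x ∧ false ] + [ y ∧ true ] ≡ [ y ]
[∧false]+[∧true] false y = cong [_] (∧-identityʳ y)
[∧false]+[∧true] true  y = cong [_] (∧-identityʳ y)

wheel-realized : ∀ c → Realizes (wheelPot (suc c)) (wheel (suc (suc c)))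
wheel-realized c = assign , orientation ∘ lookup G , realizes
  where
  G : Graph (suc (suc c))
  G = wheel (suc (suc c))

  assign : Fin (suc (suc c)) → Fin 2
  assign zero    = zero
  assign (suc _) = suc zero

  spokeEnds rimEnds : Fin (suc (suc c)) → Bool → ℕ
  spokeEnds v h = ∑[ j < suc c ] ends {k = 1} (zero , suc j) (zero , true) v (zero , h)
  rimEnds v h = ends {k = 1} (suc (fromℕ c) , suc zero) (zero , false) v (zero , h)
              + ∑[ i < c ] ends {k = 1} (suc (inject₁ i) , suc (suc i)) (zero , false) v (zero , h)

  endCount-wheel : ∀ v h → endCount G (orientation ∘ lookup G) v (zero , h) ≡ spokeEnds v h + rimEnds v h
  endCount-wheel v h = begin
    endCount G (orientation ∘ lookup G) v (zero , h)  ≡⟨ endCount-∑ G (orientation ∘ lookup G) v (zero , h) ⟩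
    ∑[ e < length G ] E (lookup G e)                  ≡⟨ ∑-lookup G E ⟩
    sum (map E G)                                     ≡⟨ sum-map-wheel c E ⟩
    spokeEnds v h + rimEnds v h                       ∎
    where
    E : Fin (suc (suc c)) × Fin (suc (suc c)) → ℕ
    E p = ends p (orientation p) v (zero , h)

  count : ∀ v h → spokeEnds v h + rimEnds v h ≡ lookup (tiles (wheelPot (suc c))) (assign v) (zero , h)
  count zero false = cong₂ _+_ (sum-replicate-zero (suc c)) (sum-replicate-zero c)
  count zero true = trans (cong₂ _+_ (∑-1 (suc c)) (sum-replicate-zero c)) (+-identityʳ (suc c))
  count (suc w) false = cong₂ _+_
    (trans (sum-cong-≗ λ j → cong [_] (∧-identityʳ (does (j ≟ w)))) (∑-[≟] w))
    (trans (cong₂ _+_ ([∧true]+[∧false] (does (fromℕ c ≟ w)) (does (zero ≟ w)))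
                      (sum-cong-≗ λ i → [∧true]+[∧false] (does (inject₁ i ≟ w)) (does (suc i ≟ w))))
           (∑-[fromℕ≟]-inject₁ c w))
  count (suc w) true = cong₂ _+_
    (trans (sum-cong-≗ λ j → cong [_] (∧-zeroʳ (does (j ≟ w)))) (sum-replicate-zero (suc c)))
    (trans (cong₂ _+_ ([∧false]+[∧true] (does (fromℕ c ≟ w)) (does (zero ≟ w)))
                      (sum-cong-≗ λ i → [∧false]+[∧true] (does (inject₁ i ≟ w)) (does (suc i ≟ w))))
           (∑-[≟] w))

  realizes : ∀ v ℓ → endCount G (orientation ∘ lookup G) v ℓ ≡ lookup (tiles (wheelPot (suc c))) (assign v) ℓ
  realizes v (zero , h) = trans (endCount-wheel v h) (count v h)

wheel-hub-degree : ∀ c → deg (wheel (suc (suc c))) zero ≡ suc c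
wheel-hub-degree c = trans
  (deg≡size (wheelPot (suc c)) (wheel (suc (suc c))) (wheel-realized c) zero)
  (+-identityʳ (suc c))

wheel-rim-degree : ∀ c (w : Fin (suc c)) → deg (wheel (suc (suc c))) (suc w) ≡ 3
wheel-rim-degree c w = deg≡size (wheelPot (suc c)) (wheel (suc (suc c))) (wheel-realized c) (suc w)

theorem2 : ∀ (n : ℕ) → 4 < n → T₁-is (wheel n) 2 × B₁-is (wheel n) 1
theorem2 zero ()
theorem2 (suc zero) (s≤s ())
theorem2 (suc (suc c)) 4<n =
    ((1 , wheelPot (suc c) , wheel-realized c , refl) , λ _ P r → irregular⇒2≤#tiles P W r zero (suc zero) hub≢rim)
  , (wheelPot (suc c) , wheel-realized c) , (λ _ P r → edge⇒1≤#bonds P W r zero)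
  where
  W : Graph (suc (suc c))
  W = wheel (suc (suc c))
  hub≢rim : deg W zero ≢ deg W (suc zero)
  hub≢rim eq = <-irrefl (sym (cong suc (trans (sym (wheel-hub-degree c)) (trans eq (wheel-rim-degree c zero))))) 4<n
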